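{- Suppose that $\phi$ is a satisfiable formula of LTL. Then any finished tableau for $\phi$ (one with no unfinished branches, built by applying the rules in any order and extending branches in any order) will be successful, i.e., will have a ticked leaf (a leaf marked with a check mark "tick" indicating a successful branch).
   Context: LTL formulas are built from atoms with $\neg$, $\wedge$, $X$, $U$ (with abbreviations $\top,\bot,\vee,\rightarrow,\leftrightarrow,F\alpha\equiv\top U\alpha, G\alpha\equiv\neg F\neg\alpha$ treated as first-class symbols), interpreted on fullpaths $\sigma$ through finite structures $(S,R,g)$ with serial $R$; $\phi$ is satisfiable iff some fullpath satisfies it. The tableau for $\phi$ is a tree whose root is labelled $\{\phi\}$ and whose nodes are labelled by sets of formulas; each leaf is ticked (successful branch), crossed (failed branch), or unfinished. A formula is elementary if it is an atom, a negated atom, or of the form $X\alpha$ or $\neg X\alpha$; a label is poised if it is non-empty, contains no pair $\alpha,\neg\alpha$, and all its formulas are elementary. Static rules: EMPTY ($\{\}$ gives a ticked leaf), $\bot$, $\neg\top$ and CONTRADICTION ($\{\alpha,\neg\alpha\}\cup\Delta$) give crossed leaves; $\top$, $\wedge$, $\neg\neg$ consume a formula into one child; $\{\alpha U\beta\}\cup\Delta$ branches to $\Delta\cup\{\beta\}$ and $\Delta\cup\{\alpha,X(\alpha U\beta)\}$; $\{\neg(\alpha U\beta)\}\cup\Delta$ branches to $\Delta\cup\{\neg\alpha,\neg\beta\}$ and $\Delta\cup\{\neg\beta,X\neg(\alpha U\beta)\}$; $\neg(\alpha\wedge\beta)$ branches to $\neg\alpha$ / $\neg\beta$ (and analogous rules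 for the abbreviations). Formulas $X(\alpha U\beta)$ or $XF\beta$ in a poised label are $X$-eventualities, fulfilled at a descendant node whose label contains $\beta$. Non-static rules for poised labels, in priority order: LOOP (if poised $v$ has a proper ancestor $u$ with poised $\Gamma_u\supseteq\Gamma_v$ and every $X$-eventuality of $\Gamma_u$ is fulfilled at some $w$ with $u<w\le v$, then $v$ is ticked); PRUNE (if $u<v<w$ share the same poised label $\Gamma$ and every $X$-eventuality of $\Gamma$ fulfilled strictly after $v$ up to $w$ was already fulfilled strictly after $u$ up to $v$, then $w$ is crossed); PRUNE$_0$ (if $u<v$ share poised label $\Gamma$ containing at least one $X$-eventuality, none of which is fulfilled in $(u,v]$, then $v$ is crossed); TRANSITION (otherwise a poised $\Gamma$ gets one child $\{\alpha\mid X\alpha\in\Gamma\}\cup\{\neg\alpha\mid\neg X\alpha\in\Gamma\}$). A tableau is successful if some leaf is ticked. -}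

module Defs where

open import Data.Nat using (ℕ; zero; suc; _≤_; _<_)
open import Data.Fin using (Fin)
open import Data.Bool using (Bool; true)
open import Data.Unit using (⊤)
open import Data.Empty using (⊥)
open import Data.Product using (Σ; ∃; _×_; _,_)
open import Data.Sum using (_⊎_)
open import Data.List using (List; []; _∷_; _∷ʳ_; length)
open import Relation.Nullary using (¬_)
open import Relation.Binary.PropositionalEquality using (_≡_; _≢_)

-- LTL formulas (abbreviations are first-class symbols)

data Formula : Set where
  atom : ℕ → Formula
  tt   : Formula
  ff   : Formula
  neg  : Formula → Formula
  and  : Formula → Formula → Formula
  or   : Formula → Formula → Formula
  imp  : Formula → Formula → Formula
  iff  : Formula → Formula → Formula
  X    : Formula → Formula
  U    : Formula → Formula → Formula
  F    : Formula → Formula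
  G    : Formula → Formula

record Structure : Set₁ where
  field
    size   : ℕ
    R      : Fin size → Fin size → Set
    serial : ∀ s → ∃ λ t → R s t
    g      : Fin size → ℕ → Bool

open Structure public

record Fullpath (M : Structure) : Set where
  field
    σ    : ℕ → Fin (size M)
    step : ∀ i → R M (σ i) (σ (suc i))

open Fullpath public

-- Sat M π i φ  :  the suffix π^{≥i} of the fullpath satisfies φ
Sat : (M : Structure) → Fullpath M → ℕ → Formula → Set
Sat M π i (atom p)  = g M (σ π i) p ≡ true
Sat M π i tt        = ⊤
Sat M π i ff        = ⊥
Sat M π i (neg α)   = ¬ Sat M π i α
Sat M π i (and α β) = Sat M π i α × Sat M π i β
Sat M π i (or α β)  = Sat M π i α ⊎ Sat M π i β
Sat M π i (imp α β) = Sat M π i α → Sat M π i β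
Sat M π i (iff α β) = (Sat M π i α → Sat M π i β) × (Sat M π i β → Sat M π i α)
Sat M π i (X α)     = Sat M π (suc i) α
Sat M π i (U α β)   = ∃ λ j → i ≤ j × Sat M π j β × (∀ k → i ≤ k → k < j → Sat M π k α)
Sat M π i (F β)     = ∃ λ j → i ≤ j × Sat M π j β
Sat M π i (G α)     = ∀ j → i ≤ j → Sat M π j α

Satisfiable : Formula → Set₁
Satisfiable φ = Σ Structure λ M → Σ (Fullpath M) λ π → Sat M π 0 φ

-- Labels: finite sets of formulas, represented by lists (up to membership)

Label : Set
Label = List Formula

open import Data.List.Membership.Propositional using (_∈_) public

_⊆ˡ_ : Label → Label → Set
Γ ⊆ˡ Δ = ∀ {x} → x ∈ Γ → x ∈ Δ

_≋_ : Label → Label → Set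
Γ ≋ Δ = Γ ⊆ˡ Δ × Δ ⊆ˡ Γ

data Elementary : Formula → Set where
  e-atom    : ∀ p → Elementary (atom p)
  e-negatom : ∀ p → Elementary (neg (atom p))
  e-X       : ∀ α → Elementary (X α)
  e-negX    : ∀ α → Elementary (neg (X α))

record Poised (Γ : Label) : Set where
  field
    nonEmpty      : ∃ λ x → x ∈ Γ
    noContradict  : ∀ α → α ∈ Γ → neg α ∈ Γ → ⊥
    allElementary : ∀ α → α ∈ Γ → Elementary α

data XEv : Formula → Formula → Set where
  xev-U : ∀ α β → XEv (X (U α β)) β
  xev-F : ∀ β → XEv (X (F β)) β

-- Branches: list of labels from the root (position 0) downwards

data At {A : Set} : List A → ℕ → A → Set where
  at-here  : ∀ {x xs} → At (x ∷ xs) zero x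
  at-there : ∀ {x y xs i} → At xs i y → At (x ∷ xs) (suc i) y

FulfilledIn : List Label → ℕ → ℕ → Formula → Set
FulfilledIn B a b β = ∃ λ l → a < l × l ≤ b × Σ Label λ L → At B l L × β ∈ L

-- Conditions for the non-static rules at the current node with label Γ,
-- whose proper ancestors (root first) are h; the current node is at
-- position length h of the branch h ∷ʳ Γ.

LoopCond : List Label → Label → Set
LoopCond h Γ =
  ∃ λ i → i < length h × Σ Label λ Γu → At h i Γu × Poised Γu × Γ ⊆ˡ Γu ×
    (∀ ψ β → ψ ∈ Γu → XEv ψ β → FulfilledIn (h ∷ʳ Γ) i (length h) β)

PruneCond : List Label → Label → Set
PruneCond h Γ =
  ∃ λ i → ∃ λ j → i < j × j < length h ×
    Σ Label λ Γi → Σ Label λ Γj → At h i Γi × At h j Γj × Γi ≋ Γ × Γj ≋ Γ ×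
    (∀ ψ β → ψ ∈ Γ → XEv ψ β →
       FulfilledIn (h ∷ʳ Γ) j (length h) β → FulfilledIn (h ∷ʳ Γ) i j β)

Prune0Cond : List Label → Label → Set
Prune0Cond h Γ =
  ∃ λ i → i < length h × Σ Label λ Γi → At h i Γi × Γi ≋ Γ ×
    (∃ λ ψ → ∃ λ β → ψ ∈ Γ × XEv ψ β) ×
    (∀ ψ β → ψ ∈ Γ → XEv ψ β → ¬ FulfilledIn (h ∷ʳ Γ) i (length h) β)

data Static1 : Formula → List Formula → Set where
  r-tt     : Static1 tt []
  r-negff  : Static1 (neg ff) []
  r-negneg : ∀ α → Static1 (neg (neg α)) (α ∷ [])
  r-and    : ∀ α β → Static1 (and α β) (α ∷ β ∷ [])
  r-negor  : ∀ α β → Static1 (neg (or α β)) (neg α ∷ neg β ∷ [])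
  r-negimp : ∀ α β → Static1 (neg (imp α β)) (α ∷ neg β ∷ [])
  r-G      : ∀ α → Static1 (G α) (α ∷ X (G α) ∷ [])
  r-negF   : ∀ β → Static1 (neg (F β)) (neg β ∷ X (neg (F β)) ∷ [])

data Static2 : Formula → List Formula → List Formula → Set where
  r-U      : ∀ α β → Static2 (U α β) (β ∷ []) (α ∷ X (U α β) ∷ [])
  r-negU   : ∀ α β → Static2 (neg (U α β)) (neg α ∷ neg β ∷ [])
                                          (neg β ∷ X (neg (U α β)) ∷ [])
  r-negand : ∀ α β → Static2 (neg (and α β)) (neg α ∷ []) (neg β ∷ [])
  r-or     : ∀ α β → Static2 (or α β) (α ∷ []) (β ∷ [])
  r-imp    : ∀ α β → Static2 (imp α β) (neg α ∷ []) (β ∷ [])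
  r-iff    : ∀ α β → Static2 (iff α β) (α ∷ β ∷ []) (neg α ∷ neg β ∷ [])
  r-negiff : ∀ α β → Static2 (neg (iff α β)) (α ∷ neg β ∷ []) (neg α ∷ β ∷ [])
  r-F      : ∀ β → Static2 (F β) (β ∷ []) (X (F β) ∷ [])
  r-negG   : ∀ α → Static2 (neg (G α)) (neg α ∷ []) (X (neg (G α)) ∷ [])

-- child label of {α} ∪ Δ (with α ∉ Δ) : the set Δ ∪ new
ChildLabel : Label → Formula → List Formula → Label → Set
ChildLabel Γ α new L =
  ∀ x → (x ∈ L → (x ∈ Γ × x ≢ α) ⊎ x ∈ new) × ((x ∈ Γ × x ≢ α) ⊎ x ∈ new → x ∈ L)

TransLabel : Label → Label → Set
TransLabel Γ L =
  ∀ x → (x ∈ L → X x ∈ Γ ⊎ (∃ λ α → neg (X α) ∈ Γ × x ≡ neg α))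
      × (X x ∈ Γ ⊎ (∃ λ α → neg (X α) ∈ Γ × x ≡ neg α) → x ∈ L)

-- Tab h Γ : a finished (sub)tableau rooted at a node
-- with label Γ whose proper ancestors have labels h (root first).  Every
-- leaf is ticked or crossed (no unfinished leaves).

data Tab (h : List Label) (Γ : Label) : Set where
  EMPTY      : Γ ≡ [] → Tab h Γ
  -- crossed leaves
  BOT        : ff ∈ Γ → Tab h Γ
  NEGTOP     : neg tt ∈ Γ → Tab h Γ
  CONTRA     : ∀ α → α ∈ Γ → neg α ∈ Γ → Tab h Γ
  STATIC1    : ∀ α new → α ∈ Γ → Static1 α new →
               (L : Label) → ChildLabel Γ α new L → Tab (h ∷ʳ Γ) L → Tab h Γ
  STATIC2    : ∀ α new₁ new₂ → α ∈ Γ → Static2 α new₁ new₂ →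
               (L₁ : Label) → ChildLabel Γ α new₁ L₁ → Tab (h ∷ʳ Γ) L₁ →
               (L₂ : Label) → ChildLabel Γ α new₂ L₂ → Tab (h ∷ʳ Γ) L₂ → Tab h Γ
  -- non-static rules (poised labels), in priority order
  LOOP       : Poised Γ → LoopCond h Γ → Tab h Γ
  PRUNE      : Poised Γ → ¬ LoopCond h Γ → PruneCond h Γ → Tab h Γ  -- crossed
  PRUNE0     : Poised Γ → ¬ LoopCond h Γ → ¬ PruneCond h Γ →
               Prune0Cond h Γ → Tab h Γ                               -- crossed
  TRANSITION : Poised Γ → ¬ LoopCond h Γ → ¬ PruneCond h Γ → ¬ Prune0Cond h Γ →
               (L : Label) → TransLabel Γ L → Tab (h ∷ʳ Γ) L → Tab h Γ

data Successful {h : List Label} {Γ : Label} : Tab h Γ → Set where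
  tick-empty : ∀ e → Successful (EMPTY e)
  tick-loop  : ∀ p c → Successful (LOOP p c)
  via-static1 : ∀ {α new m r L c t} → Successful t →
                Successful (STATIC1 α new m r L c t)
  via-static2₁ : ∀ {α new₁ new₂ m r L₁ c₁ t₁ L₂ c₂ t₂} → Successful t₁ →
                 Successful (STATIC2 α new₁ new₂ m r L₁ c₁ t₁ L₂ c₂ t₂)
  via-static2₂ : ∀ {α new₁ new₂ m r L₁ c₁ t₁ L₂ c₂ t₂} → Successful t₂ →
                 Successful (STATIC2 α new₁ new₂ m r L₁ c₁ t₁ L₂ c₂ t₂)
  via-trans   : ∀ {p nl np np0 L c t} → Successful t →
                Successful (TRANSITION p nl np np0 L c t)

{-# OPTIONS --safe #-}

-- Fix a fullpath σ satisfying φ and walk down the tableau keeping the current label true at the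
-- current position of σ: every static rule has a child that stays true (for α U β and F β the
-- first child whenever β holds now), and TRANSITION advances σ by one step.  True labels are never
-- crossed by ⊥ or CONTRADICTION, so an unsuccessful tableau makes the walk end at a PRUNE or
-- PRUNE₀ node.  Its side condition shows that an earlier poised node u with the same label could
-- have been visited at the current, later position of σ without passing any point where σ fulfils
-- an eventuality still pending at u: u can be re-anchored there.  Restarting the walk below u from
-- that position makes progress towards the point where σ fulfils the earliest pending eventuality,
-- so the restarts terminate.  The argument is classical: it refutes ¬ Successful, and success is
-- decidable.

module Submission where

open import Defs
open import Data.List using (List; []; _∷_; _∷ʳ_; length)
open import Data.List.Properties using (∷-injectiveˡ) renaming (≡-dec to List-≡-dec)
open import Data.List.Relation.Unary.Any using (here; there)
open import Data.Nat using (ℕ; zero; suc; _≤_; _<_; _∸_; z≤n; s≤s; _<?_; _≤?_) renaming (_≟_ to _≟ℕ_)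
open import Data.Nat.Properties
  using (≤-refl; ≤-trans; <-trans; <⇒≤; ≤-<-trans; <-≤-trans; <-irrefl; n≤1+n; ≤-antisym; <⇒≱; ≰⇒>; ≤∧≢⇒<;
         m≤n⇒m<n∨m≡n; m<1+n⇒m≤n; ∸-monoʳ-<)
open import Data.Nat.Induction using (<-wellFounded)
open import Induction.WellFounded using (Acc; acc)
open import Data.Product using (∃; ∃₂; _×_; _,_; proj₁; proj₂)
open import Data.Sum using (_⊎_; inj₁; inj₂; [_,_])
open import Data.Sum.Properties using () renaming (≡-dec to ⊎-≡-dec)
open import Data.Empty using (⊥; ⊥-elim)
open import Data.Unit using (⊤) renaming (tt to unit)
open import Function using (_∘_; id)
open import Relation.Nullary using (¬_; Dec; yes; no)
open import Relation.Nullary.Decidable using (map′; _×-dec_; ¬¬-excluded-middle)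
open import Relation.Nullary.Negation using (¬¬-map)
open import Relation.Binary.PropositionalEquality
  using (_≡_; _≢_; refl; sym; trans; cong; subst; module ≡-Reasoning)

-- Formulas have decidable equality because the stack machine run decodes their postfix code.

Token : Set
Token = ℕ ⊎ ℕ

postfix : Formula → List Token → List Token
postfix (atom n)  ts = inj₁ n ∷ ts
postfix tt        ts = inj₂ 0 ∷ ts
postfix ff        ts = inj₂ 1 ∷ ts
postfix (neg a)   ts = postfix a (inj₂ 2 ∷ ts)
postfix (and a b) ts = postfix a (postfix b (inj₂ 3 ∷ ts))
postfix (or a b)  ts = postfix a (postfix b (inj₂ 4 ∷ ts))
postfix (imp a b) ts = postfix a (postfix b (inj₂ 5 ∷ ts))
postfix (iff a b) ts = postfix a (postfix b (inj₂ 6 ∷ ts))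
postfix (X a)     ts = postfix a (inj₂ 7 ∷ ts)
postfix (U a b)   ts = postfix a (postfix b (inj₂ 8 ∷ ts))
postfix (F a)     ts = postfix a (inj₂ 9 ∷ ts)
postfix (G a)     ts = postfix a (inj₂ 10 ∷ ts)

push : Token → List Formula → List Formula
push (inj₁ n)  s           = atom n ∷ s
push (inj₂ 0)  s           = tt ∷ s
push (inj₂ 1)  s           = ff ∷ s
push (inj₂ 2)  (a ∷ s)     = neg a ∷ s
push (inj₂ 3)  (b ∷ a ∷ s) = and a b ∷ s
push (inj₂ 4)  (b ∷ a ∷ s) = or a b ∷ s
push (inj₂ 5)  (b ∷ a ∷ s) = imp a b ∷ s
push (inj₂ 6)  (b ∷ a ∷ s) = iff a b ∷ s
push (inj₂ 7)  (a ∷ s)     = X a ∷ s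
push (inj₂ 8)  (b ∷ a ∷ s) = U a b ∷ s
push (inj₂ 9)  (a ∷ s)     = F a ∷ s
push (inj₂ 10) (a ∷ s)     = G a ∷ s
push _         s           = s

run : List Token → List Formula → List Formula
run []       s = s
run (t ∷ ts) s = run ts (push t s)

run-postfix : ∀ a ts s → run (postfix a ts) s ≡ run ts (a ∷ s)
run-postfix (atom n)  ts s = refl
run-postfix tt        ts s = refl
run-postfix ff        ts s = refl
run-postfix (neg a)   ts s = run-postfix a _ s
run-postfix (and a b) ts s = trans (run-postfix a _ s) (run-postfix b _ (a ∷ s))
run-postfix (or a b)  ts s = trans (run-postfix a _ s) (run-postfix b _ (a ∷ s))
run-postfix (imp a b) ts s = trans (run-postfix a _ s) (run-postfix b _ (a ∷ s))
run-postfix (iff a b) ts s = trans (run-postfix a _ s) (run-postfix b _ (a ∷ s))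
run-postfix (X a)     ts s = run-postfix a _ s
run-postfix (U a b)   ts s = trans (run-postfix a _ s) (run-postfix b _ (a ∷ s))
run-postfix (F a)     ts s = run-postfix a _ s
run-postfix (G a)     ts s = run-postfix a _ s

postfix-injective : ∀ {a b} → postfix a [] ≡ postfix b [] → a ≡ b
postfix-injective {a} {b} eq = ∷-injectiveˡ (begin
  a ∷ []                ≡⟨ run-postfix a [] [] ⟨
  run (postfix a []) [] ≡⟨ cong (λ ts → run ts []) eq ⟩
  run (postfix b []) [] ≡⟨ run-postfix b [] [] ⟩
  b ∷ []                ∎)
  where open ≡-Reasoning

_≟ᶠ_ : (a b : Formula) → Dec (a ≡ b)
a ≟ᶠ b = map′ postfix-injective (cong (λ φ → postfix φ []))
              (List-≡-dec (⊎-≡-dec _≟ℕ_ _≟ℕ_) (postfix a []) (postfix b []))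

open import Data.List.Membership.DecPropositional _≟ᶠ_ using (_∈?_)

length-∷ʳ : ∀ {A : Set} (xs : List A) {z} → length (xs ∷ʳ z) ≡ suc (length xs)
length-∷ʳ []       = refl
length-∷ʳ (x ∷ xs) = cong suc (length-∷ʳ xs)

at-∷ʳ : ∀ {A : Set} {xs : List A} {i y z} → At xs i y → At (xs ∷ʳ z) i y
at-∷ʳ at-here      = at-here
at-∷ʳ (at-there a) = at-there (at-∷ʳ a)

at-∷ʳ-last : ∀ {A : Set} (xs : List A) {z} → At (xs ∷ʳ z) (length xs) z
at-∷ʳ-last []       = at-here
at-∷ʳ-last (x ∷ xs) = at-there (at-∷ʳ-last xs)

at-functional : ∀ {A : Set} {xs : List A} {i y y′} → At xs i y → At xs i y′ → y ≡ y′
at-functional at-here      at-here      = refl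
at-functional (at-there a) (at-there b) = at-functional a b

at⇒<length : ∀ {A : Set} {xs : List A} {i y} → At xs i y → i < length xs
at⇒<length at-here      = s≤s z≤n
at⇒<length (at-there a) = s≤s (at⇒<length a)

update : ∀ {A : Set} → (ℕ → A) → ℕ → A → ℕ → A
update f n v i with i ≟ℕ n
... | yes _ = v
... | no _  = f i

update-≡ : ∀ {A : Set} (f : ℕ → A) n v → update f n v n ≡ v
update-≡ f n v with n ≟ℕ n
... | yes _  = refl
... | no n≢n = ⊥-elim (n≢n refl)

update-< : ∀ {A : Set} (f : ℕ → A) {n} v {i} → i < n → update f n v i ≡ f i
update-< f {n} v {i} i<n with i ≟ℕ n
... | yes refl = ⊥-elim (<-irrefl refl i<n)
... | no _     = refl

AgreeUpTo : ∀ {A : Set} → ℕ → (ℕ → A) → (ℕ → A) → Set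
AgreeUpTo t f g = ∀ {i} → i ≤ t → f i ≡ g i

agree-sym : ∀ {A : Set} {f g : ℕ → A} {t} → AgreeUpTo t f g → AgreeUpTo t g f
agree-sym f≡g i≤t = sym (f≡g i≤t)

agree-≤ : ∀ {A : Set} {f g : ℕ → A} {s t} → s ≤ t → AgreeUpTo t f g → AgreeUpTo s f g
agree-≤ s≤t f≡g i≤s = f≡g (≤-trans i≤s s≤t)

update-agree : ∀ {A : Set} (f : ℕ → A) {n} v {t} → t < n → AgreeUpTo t (update f n v) f
update-agree f v t<n i≤t = update-< f v (≤-<-trans i≤t t<n)

¬¬-least : ∀ {Q : ℕ → Set} {m} → Acc _<_ m → Q m →
           ¬ ¬ (∃ λ a → Q a × ∀ {a′} → a′ < a → ¬ Q a′)
¬¬-least {Q} {m} (acc rs) Qm k = ¬¬-excluded-middle {A = ∃ λ a′ → a′ < m × Q a′} λ where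
  (yes (a′ , a′<m , Qa′)) → ¬¬-least (rs a′<m) Qa′ k
  (no none)               → k (m , Qm , λ a′<m Qa′ → none (_ , a′<m , Qa′))

at-and-after : ∀ {Q : ℕ → Set} {p} → Q p → (∀ i → suc p ≤ i → Q i) → ∀ i → p ≤ i → Q i
at-and-after Qp Qafter i p≤i with m≤n⇒m<n∨m≡n p≤i
... | inj₁ p<i  = Qafter i p<i
... | inj₂ refl = Qp

Fulfilled : (ℕ → Label) → ℕ → ℕ → Formula → Set
Fulfilled L a b β = ∃ λ l → a < l × l ≤ b × β ∈ L l

unfulfilled-empty : ∀ {L a b β} → b ≤ a → ¬ Fulfilled L a b β
unfulfilled-empty b≤a (l , a<l , l≤b , _) = <-irrefl refl (<-≤-trans a<l (≤-trans l≤b b≤a))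

fulfilled-widenˡ : ∀ {L a a′ b β} → a ≤ a′ → Fulfilled L a′ b β → Fulfilled L a b β
fulfilled-widenˡ a≤a′ (l , a′<l , l≤b , β∈) = l , ≤-<-trans a≤a′ a′<l , l≤b , β∈

fulfilled-widenʳ : ∀ {L a b b′ β} → b ≤ b′ → Fulfilled L a b β → Fulfilled L a b′ β
fulfilled-widenʳ b≤b′ (l , a<l , l≤b , β∈) = l , a<l , ≤-trans l≤b b≤b′ , β∈

unfulfilled-join : ∀ {L a c b β} → ¬ Fulfilled L a c β → ¬ Fulfilled L c b β → ¬ Fulfilled L a b β
unfulfilled-join {c = c} ¬ac ¬cb (l , a<l , l≤b , β∈) with l ≤? c
... | yes l≤c = ¬ac (l , a<l , l≤c , β∈)
... | no l≰c  = ¬cb (l , ≰⇒> l≰c , l≤b , β∈)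

fulfilled-agree : ∀ {L L′ a b β} → AgreeUpTo b L L′ → Fulfilled L a b β → Fulfilled L′ a b β
fulfilled-agree L≡L′ (l , a<l , l≤b , β∈) = l , a<l , l≤b , subst (_ ∈_) (L≡L′ l≤b) β∈

fulfilled? : ∀ L a b β → Dec (Fulfilled L a b β)
fulfilled? L a zero    β = no (unfulfilled-empty z≤n)
fulfilled? L a (suc b) β with fulfilled? L a b β
... | yes f = yes (fulfilled-widenʳ (n≤1+n b) f)
... | no ¬f with (a <? suc b) ×-dec (β ∈? L (suc b))
...   | yes (a<l , β∈) = yes (suc b , a<l , ≤-refl , β∈)
...   | no ¬last = no λ where
          (l , a<l , l≤b , β∈) → [ (λ l<b → ¬f (l , a<l , m<1+n⇒m≤n l<b , β∈))
                                 , (λ { refl → ¬last (a<l , β∈) }) ] (m≤n⇒m<n∨m≡n l≤b)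

BranchLabels : List Label → Label → (ℕ → Label) → ℕ → Set
BranchLabels h Γ L n = ∀ {i} → i ≤ n → At (h ∷ʳ Γ) i (L i)

module _ {h Γ L n} (depth : length h ≡ n) (branch : BranchLabels h Γ L n) where

  branch-ancestor : ∀ {i Δ} → At h i Δ → Δ ≡ L i
  branch-ancestor {i} i↦Δ = at-functional (at-∷ʳ i↦Δ) (branch (<⇒≤ (subst (i <_) depth (at⇒<length i↦Δ))))

  branch-current : L n ≡ Γ
  branch-current = at-functional (branch ≤-refl) (subst (λ m → At (h ∷ʳ Γ) m Γ) depth (at-∷ʳ-last h))

  fromFulfilledIn : ∀ {a b β} → b ≤ n → FulfilledIn (h ∷ʳ Γ) a b β → Fulfilled L a b β
  fromFulfilledIn b≤n (l , a<l , l≤b , Δ , l↦Δ , β∈) =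
    l , a<l , l≤b , subst (_ ∈_) (at-functional l↦Δ (branch (≤-trans l≤b b≤n))) β∈

  toFulfilledIn : ∀ {a b β} → b ≤ n → Fulfilled L a b β → FulfilledIn (h ∷ʳ Γ) a b β
  toFulfilledIn b≤n (l , a<l , l≤b , β∈) = l , a<l , l≤b , _ , branch (≤-trans l≤b b≤n) , β∈

  branch-extend : ∀ {Δ} → BranchLabels (h ∷ʳ Γ) Δ (update L (suc n) Δ) (suc n)
  branch-extend {Δ} {i} i≤1+n with m≤n⇒m<n∨m≡n i≤1+n
  ... | inj₁ i<1+n = subst (At ((h ∷ʳ Γ) ∷ʳ Δ) i) (sym (update-agree L Δ i<1+n ≤-refl))
                           (at-∷ʳ (branch (m<1+n⇒m≤n i<1+n)))
  ... | inj₂ refl  = subst (At ((h ∷ʳ Γ) ∷ʳ Δ) (suc n)) (sym (update-≡ L (suc n) Δ))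
                           (subst (λ m → At ((h ∷ʳ Γ) ∷ʳ Δ) m Δ) (trans (length-∷ʳ h) (cong suc depth))
                                  (at-∷ʳ-last (h ∷ʳ Γ)))

-- Eventualities

body : ∀ {ψ β} → XEv ψ β → Formula
body (xev-U α β) = U α β
body (xev-F β)   = F β

xev-≡X : ∀ {ψ β} (e : XEv ψ β) → ψ ≡ X (body e)
xev-≡X (xev-U α β) = refl
xev-≡X (xev-F β)   = refl

xev-elementary : ∀ {ψ β} → XEv ψ β → Elementary ψ
xev-elementary (xev-U α β) = e-X _
xev-elementary (xev-F β)   = e-X _

body-not-elementary : ∀ {ψ β} (e : XEv ψ β) → ¬ Elementary (body e)
body-not-elementary (xev-U α β) ()
body-not-elementary (xev-F β)   ()

AllElementary : Label → Set
AllElementary Γ = ∀ {α} → α ∈ Γ → Elementary α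

HasEventuality : Label → Set
HasEventuality Γ = ∃₂ λ ψ β → XEv ψ β × ψ ∈ Γ

poised⇒allElementary : ∀ {Γ} → Poised Γ → AllElementary Γ
poised⇒allElementary pz = Poised.allElementary pz _

poised-≋ : ∀ {Δ Γ} → Δ ≋ Γ → Poised Γ → Poised Δ
poised-≋ (Δ⊆Γ , Γ⊆Δ) pz = record
  { nonEmpty      = let (x , x∈Γ) = Poised.nonEmpty pz in x , Γ⊆Δ x∈Γ
  ; noContradict  = λ α α∈ ¬α∈ → Poised.noContradict pz α (Δ⊆Γ α∈) (Δ⊆Γ ¬α∈)
  ; allElementary = λ α α∈ → Poised.allElementary pz α (Δ⊆Γ α∈)
  }

static1-not-elementary : ∀ {α new} → Static1 α new → ¬ Elementary α
static1-not-elementary r-tt             ()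
static1-not-elementary r-negff          ()
static1-not-elementary (r-negneg α)     ()
static1-not-elementary (r-and α β)      ()
static1-not-elementary (r-negor α β)    ()
static1-not-elementary (r-negimp α β)   ()
static1-not-elementary (r-G α)          ()
static1-not-elementary (r-negF β)       ()

static2-not-elementary : ∀ {α new₁ new₂} → Static2 α new₁ new₂ → ¬ Elementary α
static2-not-elementary (r-U α β)      ()
static2-not-elementary (r-negU α β)   ()
static2-not-elementary (r-negand α β) ()
static2-not-elementary (r-or α β)     ()
static2-not-elementary (r-imp α β)    ()
static2-not-elementary (r-iff α β)    ()
static2-not-elementary (r-negiff α β) ()
static2-not-elementary (r-F β)        ()
static2-not-elementary (r-negG α)     ()

xev-≢ : ∀ {ψ β α} → XEv ψ β → ¬ Elementary α → ψ ≢ α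
xev-≢ e ¬α-el refl = ¬α-el (xev-elementary e)

child-keeps : ∀ {Γ α new Δ x} → ChildLabel Γ α new Δ → x ∈ Γ → x ≢ α → x ∈ Δ
child-keeps {x = x} c x∈Γ x≢α = proj₂ (c x) (inj₁ (x∈Γ , x≢α))

child-adds : ∀ {Γ α new Δ x} → ChildLabel Γ α new Δ → x ∈ new → x ∈ Δ
child-adds {x = x} c x∈new = proj₂ (c x) (inj₂ x∈new)

transition-unwraps : ∀ {Γ Δ x} → TransLabel Γ Δ → X x ∈ Γ → x ∈ Δ
transition-unwraps {x = x} c Xx∈Γ = proj₂ (c x) (inj₁ Xx∈Γ)

body-not-static1 : ∀ {ψ β new} (e : XEv ψ β) → ¬ Static1 (body e) new
body-not-static1 (xev-U α β) ()
body-not-static1 (xev-F β)   ()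

body-static2-first : ∀ {ψ β new₁ new₂ Γ Δ} (e : XEv ψ β) → Static2 (body e) new₁ new₂ →
                     ChildLabel Γ (body e) new₁ Δ → β ∈ Δ
body-static2-first (xev-U α β) (r-U .α .β) c = child-adds c (here refl)
body-static2-first (xev-F β)   (r-F .β)    c = child-adds c (here refl)

body-static2-second : ∀ {ψ β new₁ new₂ Γ Δ} (e : XEv ψ β) → Static2 (body e) new₁ new₂ →
                      ChildLabel Γ (body e) new₂ Δ → ψ ∈ Δ
body-static2-second (xev-U α β) (r-U .α .β) c = child-adds c (there (here refl))
body-static2-second (xev-F β)   (r-F .β)    c = child-adds c (here refl)

Carries : Label → ∀ {ψ β} → XEv ψ β → Set
Carries Γ {ψ} e = ψ ∈ Γ ⊎ body e ∈ Γ

carried-elementary : ∀ {Γ ψ β} (e : XEv ψ β) → AllElementary Γ → Carries Γ e → ψ ∈ Γ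
carried-elementary e Γ-el (inj₁ ψ∈) = ψ∈
carried-elementary e Γ-el (inj₂ b∈) = ⊥-elim (body-not-elementary e (Γ-el b∈))

PassesOn : Label → Label → Set
PassesOn Γ Δ = ∀ {ψ β} (e : XEv ψ β) → Carries Γ e → ¬ β ∈ Δ → Carries Δ e

static1-passesOn : ∀ {Γ α new Δ} → Static1 α new → ChildLabel Γ α new Δ → PassesOn Γ Δ
static1-passesOn r c e (inj₁ ψ∈) _ = inj₁ (child-keeps c ψ∈ (xev-≢ e (static1-not-elementary r)))
static1-passesOn r c e (inj₂ b∈) _ = inj₂ (child-keeps c b∈ λ { refl → body-not-static1 e r })

static2-passesOn₁ : ∀ {Γ α new₁ new₂ Δ} → Static2 α new₁ new₂ → ChildLabel Γ α new₁ Δ → PassesOn Γ Δ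
static2-passesOn₁ r c e (inj₁ ψ∈) _   = inj₁ (child-keeps c ψ∈ (xev-≢ e (static2-not-elementary r)))
static2-passesOn₁ r c e (inj₂ b∈) β∉ = inj₂ (child-keeps c b∈ λ { refl → β∉ (body-static2-first e r c) })

static2-passesOn₂ : ∀ {Γ α new₁ new₂ Δ} → Static2 α new₁ new₂ → ChildLabel Γ α new₂ Δ → PassesOn Γ Δ
static2-passesOn₂ r c e (inj₁ ψ∈) _ = inj₁ (child-keeps c ψ∈ (xev-≢ e (static2-not-elementary r)))
static2-passesOn₂ {α = α} r c e (inj₂ b∈) _ with body e ≟ᶠ α
... | yes refl = inj₁ (body-static2-second e r c)
... | no b≢α   = inj₂ (child-keeps c b∈ b≢α)

transition-passesOn : ∀ {Γ Δ} → Poised Γ → TransLabel Γ Δ → PassesOn Γ Δ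
transition-passesOn pz c e carried _ =
  inj₂ (transition-unwraps c (subst (_∈ _) (xev-≡X e)
                                     (carried-elementary e (poised⇒allElementary pz) carried)))

PendingAt : (ℕ → Label) → ℕ → ℕ → Set
PendingAt L a x = ∃₂ λ ψ β → XEv ψ β × ψ ∈ L a × ¬ Fulfilled L a x β

AllFulfilled : (ℕ → Label) → ℕ → ℕ → Set
AllFulfilled L a x = ∀ {ψ β} → XEv ψ β → ψ ∈ L a → Fulfilled L a x β

unpending⇒allFulfilled : ∀ {L a x n} → x ≤ n → ¬ PendingAt L a x → AllFulfilled L a n
unpending⇒allFulfilled {L} {a} {x} {n} x≤n ¬pending {ψ} {β} e ψ∈ with fulfilled? L a n β
... | yes f  = f
... | no ¬f = ⊥-elim (¬pending (ψ , β , e , ψ∈ , ¬f ∘ fulfilled-widenʳ x≤n))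

pending-agree : ∀ {L L′ a x} → AgreeUpTo x L L′ → a ≤ x → PendingAt L a x → PendingAt L′ a x
pending-agree L≡L′ a≤x (ψ , β , e , ψ∈ , ¬f) =
  ψ , β , e , subst (ψ ∈_) (L≡L′ a≤x) ψ∈ , ¬f ∘ fulfilled-agree (agree-sym L≡L′)

record EarliestPending (L : ℕ → Label) (x a : ℕ) (ψ β : Formula) : Set where
  field
    a≤x         : a ≤ x
    ψ∈          : ψ ∈ L a
    unfulfilled : ¬ Fulfilled L a x β
    earliest    : ∀ {a′} → a′ < a → ¬ PendingAt L a′ x

earliest-agree : ∀ {L L′ x a ψ β} → AgreeUpTo x L L′ → EarliestPending L x a ψ β → EarliestPending L′ x a ψ β
earliest-agree {ψ = ψ} L≡L′ ep = record
  { a≤x         = a≤x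
  ; ψ∈          = subst (ψ ∈_) (L≡L′ a≤x) ψ∈
  ; unfulfilled = unfulfilled ∘ fulfilled-agree (agree-sym L≡L′)
  ; earliest    = λ a′<a → earliest a′<a ∘ pending-agree (agree-sym L≡L′) (≤-trans (<⇒≤ a′<a) a≤x)
  }
  where open EarliestPending ep

¬¬-earliestPending : ∀ {L n} → PendingAt L n n →
                     ¬ ¬ (∃₂ λ a ψ → ∃₂ λ β (e : XEv ψ β) → EarliestPending L n a ψ β)
¬¬-earliestPending {n = n} pending = ¬¬-map earliest (¬¬-least (<-wellFounded n) (≤-refl , pending))
  where
  earliest : ∀ {L} → (∃ λ a → (a ≤ n × PendingAt L a n) × ∀ {a′} → a′ < a → ¬ (a′ ≤ n × PendingAt L a′ n)) →
             ∃₂ λ a ψ → ∃₂ λ β (e : XEv ψ β) → EarliestPending L n a ψ β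
  earliest (a , (a≤n , ψ , β , e , ψ∈ , ¬f) , least) = a , ψ , β , e , record
    { a≤x = a≤n ; ψ∈ = ψ∈ ; unfulfilled = ¬f
    ; earliest = λ a′<a pending → least a′<a (≤-trans (<⇒≤ a′<a) a≤n , pending) }

Persists : (ℕ → Label) → ℕ → Set
Persists L n = ∀ {a b ψ β} (e : XEv ψ β) → a < b → b ≤ n → ψ ∈ L a → ¬ Fulfilled L a b β → Carries (L b) e

carried : ∀ {L n a b ψ β} → Persists L n → a ≤ b → b ≤ n → ψ ∈ L a → ¬ Fulfilled L a b β →
          (e : XEv ψ β) → Carries (L b) e
carried persists a≤b b≤n ψ∈ ¬f e with m≤n⇒m<n∨m≡n a≤b
... | inj₁ a<b = persists e a<b b≤n ψ∈ ¬f
... | inj₂ refl = inj₁ ψ∈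

module _ {L : ℕ → Label} {n : ℕ} {Δ : Label} where

  private
    L⁺ : ℕ → Label
    L⁺ = update L (suc n) Δ

  L⁺≗L : AgreeUpTo n L⁺ L
  L⁺≗L = update-agree L Δ ≤-refl

  unfulfilled-restrict : ∀ {x β} → ¬ Fulfilled L⁺ x (suc n) β → ¬ Fulfilled L x n β
  unfulfilled-restrict ¬f = ¬f ∘ fulfilled-widenʳ (n≤1+n n) ∘ fulfilled-agree (agree-sym L⁺≗L)

  unfulfilled-new : ∀ {x β} → x < suc n → ¬ Fulfilled L⁺ x (suc n) β → ¬ β ∈ Δ
  unfulfilled-new x<1+n ¬f β∈Δ = ¬f (suc n , x<1+n , ≤-refl , subst (_ ∈_) (sym (update-≡ L (suc n) Δ)) β∈Δ)

  earliest-restrict : ∀ {x a ψ β} → x ≤ n → EarliestPending L⁺ x a ψ β → EarliestPending L x a ψ β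
  earliest-restrict x≤n = earliest-agree (agree-≤ x≤n L⁺≗L)

  elementary-restrict : ∀ {x} → x ≤ n → AllElementary (L⁺ x) → AllElementary (L x)
  elementary-restrict x≤n el = el ∘ subst (_ ∈_) (sym (L⁺≗L x≤n))

  persists-extend : ∀ {Γ} → Persists L n → L n ≡ Γ → PassesOn Γ Δ → Persists L⁺ (suc n)
  persists-extend {Γ} persists Ln≡Γ passesOn {a} {b} {ψ} e a<b b≤1+n ψ∈ ¬f with m≤n⇒m<n∨m≡n b≤1+n
  ... | inj₁ b<1+n = subst (λ Z → Carries Z e) (sym (L⁺≗Lb ≤-refl))
                           (persists e a<b (m<1+n⇒m≤n b<1+n) (subst (ψ ∈_) (L⁺≗Lb (<⇒≤ a<b)) ψ∈)
                                     (¬f ∘ fulfilled-agree (agree-sym L⁺≗Lb)))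
    where
    L⁺≗Lb : AgreeUpTo b L⁺ L
    L⁺≗Lb = update-agree L Δ b<1+n
  ... | inj₂ refl = subst (λ Z → Carries Z e) (sym (update-≡ L (suc n) Δ))
                          (passesOn e (subst (λ Z → Carries Z e) Ln≡Γ carriedNow) (unfulfilled-new a<b ¬f))
    where
    carriedNow : Carries (L n) e
    carriedNow = carried persists (m<1+n⇒m≤n a<b) ≤-refl (subst (ψ ∈_) (L⁺≗L (m<1+n⇒m≤n a<b)) ψ∈)
                         (unfulfilled-restrict ¬f) e

PruneWitness : (ℕ → Label) → ℕ → ℕ → Label → Set
PruneWitness L n t Γ = ∀ {ψ β} → XEv ψ β → ψ ∈ Γ → Fulfilled L t n β →
                       ∃ λ u → u < t × Fulfilled L u t β × ¬ AllFulfilled L u n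

-- Following a fullpath down the tableau

module Semantics (M : Structure) (π : Fullpath M) where

  infix 4 _⊨_ _⊨ˡ_

  _⊨_ : ℕ → Formula → Set
  k ⊨ φ = Sat M π k φ

  _⊨ˡ_ : ℕ → Label → Set
  p ⊨ˡ Γ = ∀ {x} → x ∈ Γ → p ⊨ x

  ⊨-one : ∀ {p a} → p ⊨ a → p ⊨ˡ a ∷ []
  ⊨-one ⊨a (here refl) = ⊨a

  ⊨-two : ∀ {p a b} → p ⊨ a → p ⊨ b → p ⊨ˡ a ∷ b ∷ []
  ⊨-two ⊨a ⊨b (here refl)         = ⊨a
  ⊨-two ⊨a ⊨b (there (here refl)) = ⊨b

  -- The second child of an eventuality rule is only chosen while its β is false.
  Postponed : Formula → ℕ → Set
  Postponed (U α β) p = ¬ p ⊨ β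
  Postponed (F β)   p = ¬ p ⊨ β
  Postponed _       p = ⊤

  static1-sound : ∀ {p α new} → p ⊨ α → Static1 α new → ¬ ¬ (p ⊨ˡ new)
  static1-sound _ r-tt k = k λ ()
  static1-sound _ r-negff k = k λ ()
  static1-sound ⊨¬¬α (r-negneg α) k = ⊨¬¬α (k ∘ ⊨-one)
  static1-sound (⊨α , ⊨β) (r-and α β) k = k (⊨-two ⊨α ⊨β)
  static1-sound ⊨¬∨ (r-negor α β) k = k (⊨-two (⊨¬∨ ∘ inj₁) (⊨¬∨ ∘ inj₂))
  static1-sound ⊨¬⇒ (r-negimp α β) k = ⊨¬⇒ λ ⊨α → ⊥-elim (k (⊨-two ⊨α λ ⊨β → ⊨¬⇒ λ _ → ⊨β))
  static1-sound {p} ⊨G (r-G α) k = k (⊨-two (⊨G p ≤-refl) λ j p<j → ⊨G j (<⇒≤ p<j))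
  static1-sound {p} ⊨¬F (r-negF β) k =
    k (⊨-two (λ ⊨β → ⊨¬F (p , ≤-refl , ⊨β)) λ { (j , p<j , ⊨β) → ⊨¬F (j , <⇒≤ p<j , ⊨β) })

  static2-sound : ∀ {p α new₁ new₂} → p ⊨ α → Static2 α new₁ new₂ →
                  ¬ ¬ (p ⊨ˡ new₁ ⊎ (p ⊨ˡ new₂ × Postponed α p))
  static2-sound {p} (j , p≤j , ⊨β , ⊨α) (r-U α β) k = ¬¬-excluded-middle {A = p ⊨ β} λ where
    (yes ⊨βp) → k (inj₁ (⊨-one ⊨βp))
    (no ⊭βp)  → let p<j = ≤∧≢⇒< p≤j λ { refl → ⊭βp ⊨β } in
      k (inj₂ (⊨-two (⊨α p ≤-refl p<j) (j , p<j , ⊨β , λ i p<i → ⊨α i (<⇒≤ p<i)) , ⊭βp))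
  static2-sound {p} ⊭U (r-negU α β) k = ¬¬-excluded-middle {A = p ⊨ α} case
    where
    ⊭β : ¬ p ⊨ β
    ⊭β ⊨β = ⊭U (p , ≤-refl , ⊨β , λ i p≤i i<p → ⊥-elim (<⇒≱ i<p p≤i))
    case : Dec (p ⊨ α) → ⊥
    case (no ⊭α)  = k (inj₁ (⊨-two ⊭α ⊭β))
    case (yes ⊨α) = k (inj₂ (⊨-two ⊭β (λ (j , p<j , ⊨β , ⊨α′) →
                      ⊭U (j , <⇒≤ p<j , ⊨β , at-and-after (λ _ → ⊨α) ⊨α′)) , unit))
  static2-sound {p} ⊭∧ (r-negand α β) k = ¬¬-excluded-middle {A = p ⊨ α} λ where
    (no ⊭α)  → k (inj₁ (⊨-one ⊭α))
    (yes ⊨α) → k (inj₂ (⊨-one (λ ⊨β → ⊭∧ (⊨α , ⊨β)) , unit))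
  static2-sound (inj₁ ⊨α) (r-or α β) k = k (inj₁ (⊨-one ⊨α))
  static2-sound (inj₂ ⊨β) (r-or α β) k = k (inj₂ (⊨-one ⊨β , unit))
  static2-sound {p} ⊨⇒ (r-imp α β) k = ¬¬-excluded-middle {A = p ⊨ α} λ where
    (no ⊭α)  → k (inj₁ (⊨-one ⊭α))
    (yes ⊨α) → k (inj₂ (⊨-one (⊨⇒ ⊨α) , unit))
  static2-sound {p} (⊨⇒ , ⊨⇐) (r-iff α β) k = ¬¬-excluded-middle {A = p ⊨ α} λ where
    (yes ⊨α) → k (inj₁ (⊨-two ⊨α (⊨⇒ ⊨α)))
    (no ⊭α)  → k (inj₂ (⊨-two ⊭α (⊭α ∘ ⊨⇐) , unit))
  static2-sound {p} ⊭⇔ (r-negiff α β) k =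
    ¬¬-excluded-middle {A = p ⊨ α} λ α? → ¬¬-excluded-middle {A = p ⊨ β} λ β? → case α? β?
    where
    case : Dec (p ⊨ α) → Dec (p ⊨ β) → ⊥
    case (yes ⊨α) (yes ⊨β) = ⊭⇔ ((λ _ → ⊨β) , (λ _ → ⊨α))
    case (yes ⊨α) (no ⊭β)  = k (inj₁ (⊨-two ⊨α ⊭β))
    case (no ⊭α)  (yes ⊨β) = k (inj₂ (⊨-two ⊭α ⊨β , unit))
    case (no ⊭α)  (no ⊭β)  = ⊭⇔ ((⊥-elim ∘ ⊭α) , (⊥-elim ∘ ⊭β))
  static2-sound {p} (j , p≤j , ⊨β) (r-F β) k = ¬¬-excluded-middle {A = p ⊨ β} λ where
    (yes ⊨βp) → k (inj₁ (⊨-one ⊨βp))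
    (no ⊭βp)  → k (inj₂ (⊨-one (j , ≤∧≢⇒< p≤j (λ { refl → ⊭βp ⊨β }) , ⊨β) , ⊭βp))
  static2-sound {p} ⊭G (r-negG α) k = ¬¬-excluded-middle {A = p ⊨ α} λ where
    (no ⊭α)  → k (inj₁ (⊨-one ⊭α))
    (yes ⊨α) → k (inj₂ (⊨-one (λ ⊨Gnext → ⊭G (at-and-after ⊨α ⊨Gnext)) , unit))

  child-sound : ∀ {p Γ α new Δ} → p ⊨ˡ Γ → ChildLabel Γ α new Δ → p ⊨ˡ new → p ⊨ˡ Δ
  child-sound ⊨Γ c ⊨new {x} x∈Δ = [ ⊨Γ ∘ proj₁ , ⊨new ] (proj₁ (c x) x∈Δ)

  transition-sound : ∀ {p Γ Δ} → p ⊨ˡ Γ → TransLabel Γ Δ → suc p ⊨ˡ Δ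
  transition-sound ⊨Γ c {x} x∈Δ with proj₁ (c x) x∈Δ
  ... | inj₁ Xx∈Γ                = ⊨Γ Xx∈Γ
  ... | inj₂ (α , ¬Xα∈Γ , refl) = ⊨Γ ¬Xα∈Γ

  body-eventually : ∀ {ψ β k} (e : XEv ψ β) → k ⊨ body e → ∃ λ D → k ≤ D × D ⊨ β
  body-eventually (xev-U α β) (j , k≤j , ⊨β , _) = j , k≤j , ⊨β
  body-eventually (xev-F β)   ⊨Fβ                = ⊨Fβ

  postponed-body : ∀ {p ψ β} (e : XEv ψ β) → Postponed (body e) p → ¬ p ⊨ β
  postponed-body (xev-U α β) ⊭β = ⊭β
  postponed-body (xev-F β)   ⊭β = ⊭β

  KeepsBodies : ℕ → Label → Label → Set
  KeepsBodies p Γ Δ = ∀ {ψ β} (e : XEv ψ β) → body e ∈ Γ → p ⊨ β → ¬ β ∈ Δ → body e ∈ Δ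

  static1-keepsBodies : ∀ {p Γ α new Δ} → Static1 α new → ChildLabel Γ α new Δ → KeepsBodies p Γ Δ
  static1-keepsBodies r c e b∈ _ _ = child-keeps c b∈ λ { refl → body-not-static1 e r }

  static2-keepsBodies₁ : ∀ {p Γ α new₁ new₂ Δ} → Static2 α new₁ new₂ → ChildLabel Γ α new₁ Δ →
                         KeepsBodies p Γ Δ
  static2-keepsBodies₁ r c e b∈ _ β∉ = child-keeps c b∈ λ { refl → β∉ (body-static2-first e r c) }

  static2-keepsBodies₂ : ∀ {p Γ α new₁ new₂ Δ} → Static2 α new₁ new₂ → ChildLabel Γ α new₂ Δ →
                         Postponed α p → KeepsBodies p Γ Δ
  static2-keepsBodies₂ r c postponed e b∈ ⊨β _ = child-keeps c b∈ λ { refl → postponed-body e postponed ⊨β }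

  -- L i is the label at depth i of the branch being followed, P x the position of the fullpath
  -- at which its node x was visited.

  FulfilmentOnlyNow : (ℕ → Label) → (ℕ → ℕ) → ℕ → ℕ → Label → Set
  FulfilmentOnlyNow L P n p Γ =
    ∀ {x a ψ β} (e : XEv ψ β) → x < n → EarliestPending L x a ψ β → ¬ Fulfilled L x n β →
    ∀ {k} → P x < k → k ≤ p → k ⊨ β → k ≡ p × body e ∈ Γ

  NoFulfilmentSkipped : (ℕ → Label) → (ℕ → ℕ) → ℕ → ℕ → Set
  NoFulfilmentSkipped L P t q =
    ∀ {x a ψ β} → XEv ψ β → x ≤ t → EarliestPending L x a ψ β → ¬ Fulfilled L x t β →
    ∀ {k} → P x < k → k ≤ q → ¬ k ⊨ β

  PoisedBefore : (ℕ → Label) → (ℕ → ℕ) → ℕ → ℕ → Set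
  PoisedBefore L P n p = ∀ {x} → x < n → AllElementary (L x) → P x < p

  -- Node t could have been visited at the later position q instead of P t.
  record Reanchoring (L : ℕ → Label) (P : ℕ → ℕ) (t q : ℕ) : Set where
    field
      later       : P t < q
      holds       : q ⊨ˡ L t
      elementary  : AllElementary (L t)
      eventuality : HasEventuality (L t)
      noSkip      : NoFulfilmentSkipped L P t q

  CanReanchor : (ℕ → Label) → (ℕ → ℕ) → ℕ → Set
  CanReanchor L P n = ∃₂ λ t q → t < n × Reanchoring L P t q

  record Invariant (h : List Label) (Γ : Label) (L : ℕ → Label) (P : ℕ → ℕ) (n p : ℕ) : Set where
    field
      depth        : length h ≡ n
      branch       : BranchLabels h Γ L n
      holds        : p ⊨ˡ Γ
      persists     : Persists L n
      onlyNow      : FulfilmentOnlyNow L P n p Γ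
      poisedBefore : PoisedBefore L P n p

    current : L n ≡ Γ
    current = branch-current depth branch

  module _ {L : ℕ → Label} {P : ℕ → ℕ} {n p : ℕ} {Δ : Label} where

    private
      L⁺ : ℕ → Label
      L⁺ = update L (suc n) Δ
      P⁺ : ℕ → ℕ
      P⁺ = update P n p

    onlyNow-static : ∀ {Γ} → FulfilmentOnlyNow L P n p Γ → KeepsBodies p Γ Δ →
                     FulfilmentOnlyNow L⁺ P⁺ (suc n) p Δ
    onlyNow-static onlyNow keeps {β = β} e x<1+n ep ¬f {k} P⁺x<k k≤p ⊨β with m≤n⇒m<n∨m≡n (m<1+n⇒m≤n x<1+n)
    ... | inj₂ refl = ⊥-elim (<⇒≱ (subst (_< k) (update-≡ P n p) P⁺x<k) k≤p)
    ... | inj₁ x<n  =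
      let (k≡p , b∈Γ) = onlyNow e x<n (earliest-restrict (<⇒≤ x<n) ep) (unfulfilled-restrict ¬f)
                                (subst (_< k) (update-< P p x<n) P⁺x<k) k≤p ⊨β
      in k≡p , keeps e b∈Γ (subst (_⊨ β) k≡p ⊨β) (unfulfilled-new x<1+n ¬f)

    onlyNow-transition : ∀ {Γ} → Poised Γ → Persists L n → L n ≡ Γ → FulfilmentOnlyNow L P n p Γ →
                         TransLabel Γ Δ → FulfilmentOnlyNow L⁺ P⁺ (suc n) (suc p) Δ
    onlyNow-transition {Γ} pz persists Ln≡Γ onlyNow c {x} {a} {ψ} {β} e x<1+n ep ¬f {k} P⁺x<k k≤1+p ⊨β =
      ≤-antisym k≤1+p p<k , transition-unwraps c (subst (_∈ Γ) (xev-≡X e) ψ∈Γ)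
      where
      x≤n = m<1+n⇒m≤n x<1+n
      ep′ = earliest-restrict x≤n ep
      open EarliestPending ep′
      Γ-el : AllElementary Γ
      Γ-el = poised⇒allElementary pz
      ψ∈Γ : ψ ∈ Γ
      ψ∈Γ = carried-elementary e Γ-el (subst (λ Z → Carries Z e) Ln≡Γ
              (carried persists (≤-trans a≤x x≤n) ≤-refl ψ∈
                       (unfulfilled-join unfulfilled (unfulfilled-restrict ¬f)) e))
      p<k : p < k
      p<k with m≤n⇒m<n∨m≡n x≤n
      ... | inj₂ refl = subst (_< k) (update-≡ P n p) P⁺x<k
      ... | inj₁ x<n  with k ≤? p
      ...   | no k≰p = ≰⇒> k≰p
      ...   | yes k≤p = ⊥-elim (body-not-elementary e (Γ-el (proj₂
                          (onlyNow e x<n ep′ (unfulfilled-restrict ¬f)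
                                   (subst (_< k) (update-< P p x<n) P⁺x<k) k≤p ⊨β))))

    poisedBefore-static : PoisedBefore L P n p → ¬ AllElementary (L n) → PoisedBefore L⁺ P⁺ (suc n) p
    poisedBefore-static poisedBefore ¬el {x} x<1+n el with m≤n⇒m<n∨m≡n (m<1+n⇒m≤n x<1+n)
    ... | inj₂ refl = ⊥-elim (¬el (elementary-restrict {L} {n} {Δ} ≤-refl el))
    ... | inj₁ x<n  = subst (_< p) (sym (update-< P p x<n))
                            (poisedBefore x<n (elementary-restrict (<⇒≤ x<n) el))

    poisedBefore-transition : PoisedBefore L P n p → PoisedBefore L⁺ P⁺ (suc n) (suc p)
    poisedBefore-transition poisedBefore {x} x<1+n el with m≤n⇒m<n∨m≡n (m<1+n⇒m≤n x<1+n)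
    ... | inj₂ refl = subst (_< suc p) (sym (update-≡ P n p)) ≤-refl
    ... | inj₁ x<n  = subst (_< suc p) (sym (update-< P p x<n))
                            (≤-trans (poisedBefore x<n (elementary-restrict (<⇒≤ x<n) el)) (n≤1+n p))

    reanchoring-restrict : ∀ {t q} → t < n → Reanchoring L⁺ P⁺ t q → Reanchoring L P t q
    reanchoring-restrict {t} {q} t<n r = record
      { later       = subst (_< q) (update-< P p t<n) later
      ; holds       = holds ∘ subst (_ ∈_) (sym (L⁺≗Lt ≤-refl))
      ; elementary  = elementary ∘ subst (_ ∈_) (sym (L⁺≗Lt ≤-refl))
      ; eventuality = let (ψ , β , e , ψ∈) = eventuality in ψ , β , e , subst (ψ ∈_) (L⁺≗Lt ≤-refl) ψ∈
      ; noSkip      = λ {x} e x≤t ep ¬f {k} Px<k →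
          noSkip e x≤t (earliest-agree (agree-≤ x≤t (agree-sym L⁺≗Lt)) ep) (¬f ∘ fulfilled-agree L⁺≗Lt)
                 (subst (_< k) (sym (update-< P p (≤-<-trans x≤t t<n))) Px<k)
      }
      where
      open Reanchoring r
      L⁺≗Lt : AgreeUpTo t L⁺ L
      L⁺≗Lt = update-agree L Δ (≤-trans t<n (n≤1+n n))

    reanchor-split : CanReanchor L⁺ P⁺ (suc n) → CanReanchor L P n ⊎ ∃ (Reanchoring L⁺ P⁺ n)
    reanchor-split (t , q , t<1+n , r) with m≤n⇒m<n∨m≡n (m<1+n⇒m≤n t<1+n)
    ... | inj₁ t<n  = inj₁ (t , q , t<n , reanchoring-restrict t<n r)
    ... | inj₂ refl = inj₂ (q , r)

    reanchoring-before : ∀ {a ψ β q D} → XEv ψ β → EarliestPending L n a ψ β → Reanchoring L⁺ P⁺ n q →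
                         p < D → D ⊨ β → q < D
    reanchoring-before e ep r p<D ⊨β = ≰⇒> λ D≤q →
      Reanchoring.noSkip r e ≤-refl (earliest-agree (agree-sym (L⁺≗L {L} {n} {Δ})) ep)
        (unfulfilled-empty ≤-refl) (subst (_< _) (sym (update-≡ P n p)) p<D) D≤q ⊨β

  module _ {h Γ L P n p} (I : Invariant h Γ L P n p) where

    open Invariant I

    pending-fulfilled-later : Poised Γ → ∀ {a ψ β} → XEv ψ β → EarliestPending L n a ψ β →
                              ∃ λ D → p < D × D ⊨ β
    pending-fulfilled-later pz e ep = body-eventually e (holds (subst (_∈ Γ) (xev-≡X e) ψ∈Γ))
      where
      open EarliestPending ep
      ψ∈Γ : _ ∈ Γ
      ψ∈Γ = carried-elementary e (poised⇒allElementary pz)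
              (subst (λ Z → Carries Z e) current (carried persists a≤x ≤-refl ψ∈ unfulfilled e))

    static-step : ∀ {Δ} → ¬ AllElementary Γ → p ⊨ˡ Δ → PassesOn Γ Δ → KeepsBodies p Γ Δ →
                  Invariant (h ∷ʳ Γ) Δ (update L (suc n) Δ) (update P n p) (suc n) p
    static-step ¬el ⊨Δ passesOn keeps = record
      { depth        = trans (length-∷ʳ h) (cong suc depth)
      ; branch       = branch-extend depth branch
      ; holds        = ⊨Δ
      ; persists     = persists-extend persists current passesOn
      ; onlyNow      = onlyNow-static onlyNow keeps
      ; poisedBefore = poisedBefore-static poisedBefore (¬el ∘ subst AllElementary current)
      }

    transition-step : ∀ {Δ} → Poised Γ → TransLabel Γ Δ →
                      Invariant (h ∷ʳ Γ) Δ (update L (suc n) Δ) (update P n p) (suc n) (suc p)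
    transition-step pz c = record
      { depth        = trans (length-∷ʳ h) (cong suc depth)
      ; branch       = branch-extend depth branch
      ; holds        = transition-sound holds c
      ; persists     = persists-extend persists current (transition-passesOn pz c)
      ; onlyNow      = onlyNow-transition pz persists current onlyNow c
      ; poisedBefore = poisedBefore-transition poisedBefore
      }

    reanchored : ∀ {Δ q} → Reanchoring (update L (suc n) Δ) (update P n p) n q → Invariant h Γ L P n q
    reanchored {Δ} {q} r = record
      { depth        = depth
      ; branch       = branch
      ; holds        = R.holds ∘ subst (_ ∈_) Γ≡L⁺n
      ; persists     = persists
      ; onlyNow      = λ {x} e x<n ep ¬f Px<k k≤q ⊨β → ⊥-elim
          (R.noSkip e (<⇒≤ x<n) (earliest-agree (agree-≤ (<⇒≤ x<n) (agree-sym L⁺≗L)) ep)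
                    (¬f ∘ fulfilled-agree L⁺≗L) (subst (_< _) (sym (update-< P p x<n)) Px<k) k≤q ⊨β)
      ; poisedBefore = λ x<n el → <-trans (poisedBefore x<n el) (subst (_< q) (update-≡ P n p) R.later)
      }
      where
      module R = Reanchoring r
      Γ≡L⁺n : Γ ≡ update L (suc n) Δ n
      Γ≡L⁺n = sym (trans (L⁺≗L {L} {n} {Δ} ≤-refl) current)

  prune-noSkip : ∀ {L P n p Γ t} → Persists L n → AllElementary Γ → t < n → L t ≋ Γ →
                 FulfilmentOnlyNow L P n p Γ → PruneWitness L n t Γ → NoFulfilmentSkipped L P t p
  prune-noSkip {L} {t = t} persists Γ-el t<n (Lt⊆Γ , _) onlyNow witness {x} {a} {β = β}
               e x≤t ep ¬f Px<k k≤p ⊨β =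
    body-not-elementary e (Γ-el (proj₂
      (onlyNow e (≤-<-trans x≤t t<n) ep (unfulfilled-join ¬f ¬fulfilledAfter) Px<k k≤p ⊨β)))
    where
    open EarliestPending ep
    ¬fulfilledSince : ¬ Fulfilled L a t β
    ¬fulfilledSince = unfulfilled-join unfulfilled ¬f
    ψ∈Lt : _ ∈ L t
    ψ∈Lt = carried-elementary e (Γ-el ∘ Lt⊆Γ)
             (carried persists (≤-trans a≤x x≤t) (<⇒≤ t<n) ψ∈ ¬fulfilledSince e)
    -- A fulfilment after t repeats one in (u, t]: u ≥ a contradicts ¬fulfilledSince, u < a earliest.
    ¬fulfilledAfter : ¬ Fulfilled L t _ β
    ¬fulfilledAfter f with witness e (Lt⊆Γ ψ∈Lt) f
    ... | u , u<t , fulfilled , ¬all with a ≤? u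
    ...   | yes a≤u = ¬fulfilledSince (fulfilled-widenˡ a≤u fulfilled)
    ...   | no a≰u  = ¬all (unpending⇒allFulfilled (<⇒≤ (≤-<-trans x≤t t<n)) (earliest (≰⇒> a≰u)))

  module _ {h Γ L P n p} (I : Invariant h Γ L P n p) (pz : Poised Γ) where

    open Invariant I

    prune-reanchoring : ∀ {t} → t < n → L t ≋ Γ → HasEventuality (L t) → PruneWitness L n t Γ →
                        Reanchoring L P t p
    prune-reanchoring {t} t<n Lt≋Γ ev witness = record
      { later       = poisedBefore t<n Lt-el
      ; holds       = holds ∘ proj₁ Lt≋Γ
      ; elementary  = Lt-el
      ; eventuality = ev
      ; noSkip      = prune-noSkip persists Γ-el t<n Lt≋Γ onlyNow witness
      }
      where
      Γ-el : AllElementary Γ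
      Γ-el = poised⇒allElementary pz
      Lt-el : AllElementary (L t)
      Lt-el = Γ-el ∘ proj₁ Lt≋Γ

  module _ {h Γ L P p} (I : Invariant h Γ L P (length h) p) (pz : Poised Γ) where

    open Invariant I

    ancestor : ∀ {i Δ} → At h i Δ → Δ ≡ L i
    ancestor = branch-ancestor depth branch

    relabel : ∀ {i Δ} → At h i Δ → Δ ≋ Γ → L i ≋ Γ
    relabel i↦Δ = subst (_≋ Γ) (ancestor i↦Δ)

    prune-leaf : ¬ LoopCond h Γ → PruneCond h Γ → ¬ ¬ CanReanchor L P (length h)
    prune-leaf ¬loop (i , j , i<j , j<n , Γi , Γj , i↦Γi , j↦Γj , Γi≋Γ , Γj≋Γ , cond) k =
      ¬¬-excluded-middle {A = HasEventuality (L j)} λ where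
        (yes ev) → k (j , p , j<n , prune-reanchoring I pz j<n (relabel j↦Γj Γj≋Γ) ev witness)
        (no none) → ¬loop (j , j<n , Γj , j↦Γj , poised-≋ Γj≋Γ pz , proj₂ Γj≋Γ ,
                           λ ψ β ψ∈ e → ⊥-elim (none (ψ , β , e , subst (ψ ∈_) (ancestor j↦Γj) ψ∈)))
      where
      witness : PruneWitness L (length h) j Γ
      witness {ψ} {β} e ψ∈ f =
        i , i<j , fromFulfilledIn depth branch (<⇒≤ j<n) (cond ψ β ψ∈ e (toFulfilledIn depth branch ≤-refl f)) ,
        λ all → ¬loop (i , <-trans i<j j<n , Γi , i↦Γi , poised-≋ Γi≋Γ pz , proj₂ Γi≋Γ ,
                       λ γ β′ γ∈ e′ → toFulfilledIn depth branch ≤-refl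
                                        (all e′ (subst (γ ∈_) (ancestor i↦Γi) γ∈)))

    prune0-leaf : Prune0Cond h Γ → CanReanchor L P (length h)
    prune0-leaf (i , i<n , Γi , i↦Γi , Γi≋Γ , (ψ , β , ψ∈ , e) , none) =
      i , p , i<n ,
      prune-reanchoring I pz i<n (relabel i↦Γi Γi≋Γ)
        (ψ , β , e , subst (ψ ∈_) (ancestor i↦Γi) (proj₂ Γi≋Γ ψ∈))
        (λ e′ ψ′∈ f → ⊥-elim (none _ _ ψ′∈ e′ (toFulfilledIn depth branch ≤-refl f)))

  mutual

    walk : ∀ {h Γ L P n p} (t : Tab h Γ) → ¬ Successful t → Invariant h Γ L P n p → ¬ ¬ CanReanchor L P n
    walk (EMPTY Γ≡[])     ns _ _ = ns (tick-empty Γ≡[])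
    walk (BOT ff∈)        _  I _ = Invariant.holds I ff∈
    walk (NEGTOP ¬tt∈)    _  I _ = Invariant.holds I ¬tt∈ unit
    walk (CONTRA α α∈ ¬α∈) _ I _ = Invariant.holds I ¬α∈ (Invariant.holds I α∈)
    walk (STATIC1 α new α∈ r Δ c t) ns I k =
      static1-sound (Invariant.holds I α∈) r λ ⊨new →
        walk-static t (ns ∘ via-static1) I (λ el → static1-not-elementary r (el α∈))
          (child-sound (Invariant.holds I) c ⊨new) (static1-passesOn r c) (static1-keepsBodies r c) k
    walk (STATIC2 α new₁ new₂ α∈ r Δ₁ c₁ t₁ Δ₂ c₂ t₂) ns I k =
      static2-sound (Invariant.holds I α∈) r λ where
        (inj₁ ⊨new₁) →
          walk-static t₁ (ns ∘ via-static2₁) I ¬el (child-sound (Invariant.holds I) c₁ ⊨new₁)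
            (static2-passesOn₁ r c₁) (static2-keepsBodies₁ r c₁) k
        (inj₂ (⊨new₂ , postponed)) →
          walk-static t₂ (ns ∘ via-static2₂) I ¬el (child-sound (Invariant.holds I) c₂ ⊨new₂)
            (static2-passesOn₂ r c₂) (static2-keepsBodies₂ r c₂ postponed) k
      where
      ¬el : ¬ AllElementary _
      ¬el el = static2-not-elementary r (el α∈)
    walk (LOOP pz c) ns _ _ = ns (tick-loop pz c)
    walk (PRUNE pz ¬loop c) _ I with Invariant.depth I
    ... | refl = prune-leaf I pz ¬loop c
    walk (PRUNE0 pz _ _ c) _ I k with Invariant.depth I
    ... | refl = k (prune0-leaf I pz c)
    walk (TRANSITION pz _ _ _ Δ c t) ns I = walk-transition pz c t (ns ∘ via-trans) I

    walk-static : ∀ {h Γ L P n p Δ} (t : Tab (h ∷ʳ Γ) Δ) → ¬ Successful t → Invariant h Γ L P n p →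
                  ¬ AllElementary Γ → p ⊨ˡ Δ → PassesOn Γ Δ → KeepsBodies p Γ Δ → ¬ ¬ CanReanchor L P n
    walk-static {Γ = Γ} {L} {n = n} {Δ = Δ} t ns I ¬el ⊨Δ passesOn keeps =
      ¬¬-map ([ id , (λ (_ , r) → ⊥-elim (¬el (elementary-now r))) ] ∘ reanchor-split)
             (walk t ns (static-step I ¬el ⊨Δ passesOn keeps))
      where
      elementary-now : ∀ {P q} → Reanchoring (update L (suc n) Δ) P n q → AllElementary Γ
      elementary-now r = subst AllElementary (Invariant.current I)
                               (elementary-restrict {L} {n} {Δ} ≤-refl (Reanchoring.elementary r))

    walk-transition : ∀ {h Γ L P n p Δ} → Poised Γ → TransLabel Γ Δ → (t : Tab (h ∷ʳ Γ) Δ) → ¬ Successful t →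
                      Invariant h Γ L P n p → ¬ ¬ CanReanchor L P n
    walk-transition {h} {Γ} {L} {P} {n} {p} {Δ} pz c t ns I k =
      ¬¬-excluded-middle {A = HasEventuality Γ} λ where
        (no none) → visit I λ (_ , r) → none (eventuality-now r)
        (yes (ψ , β , e , ψ∈Γ)) →
          ¬¬-earliestPending (ψ , β , e , subst (ψ ∈_) (sym current) ψ∈Γ , unfulfilled-empty ≤-refl)
            λ (_ , _ , _ , e , ep) → let (D , p<D , ⊨β) = pending-fulfilled-later I pz e ep in
              chase e ep ⊨β (<-wellFounded (D ∸ p)) p<D I
      where
      open Invariant I
      L⁺ : ℕ → Label
      L⁺ = update L (suc n) Δ
      visit : ∀ {p′} → Invariant h Γ L P n p′ → (∃ (Reanchoring L⁺ (update P n p′) n) → ⊥) → ⊥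
      visit I′ onReanchor = walk t ns (transition-step I′ pz c) ([ k , onReanchor ] ∘ reanchor-split)
      eventuality-now : ∀ {P q} → Reanchoring L⁺ P n q → HasEventuality Γ
      eventuality-now r = let (ψ , β , e , ψ∈) = Reanchoring.eventuality r in
        ψ , β , e , subst (ψ ∈_) (trans (L⁺≗L {L} {n} {Δ} ≤-refl) current) ψ∈
      -- Each retry re-anchors node n strictly later in the model, yet before D, where β holds.
      chase : ∀ {a ψ β D p′} → XEv ψ β → EarliestPending L n a ψ β → D ⊨ β →
              Acc _<_ (D ∸ p′) → p′ < D → Invariant h Γ L P n p′ → ⊥
      chase {p′ = p′} e ep ⊨β (acc rs) p′<D I′ = visit I′ λ (q , r) →
        let p′<q = subst (_< q) (update-≡ P n p′) (Reanchoring.later r)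
            q<D  = reanchoring-before e ep r p′<D ⊨β
        in chase e ep ⊨β (rs (∸-monoʳ-< p′<q (<⇒≤ q<D))) q<D (reanchored I′ r)

successful? : ∀ {h Γ} (t : Tab h Γ) → Dec (Successful t)
successful? (EMPTY Γ≡[]) = yes (tick-empty Γ≡[])
successful? (BOT _) = no λ ()
successful? (NEGTOP _) = no λ ()
successful? (CONTRA _ _ _) = no λ ()
successful? (STATIC1 _ _ _ _ _ _ t) = map′ via-static1 (λ { (via-static1 s) → s }) (successful? t)
successful? (STATIC2 _ _ _ _ _ _ _ t₁ _ _ t₂) with successful? t₁ | successful? t₂
... | yes s₁ | _      = yes (via-static2₁ s₁)
... | no _   | yes s₂ = yes (via-static2₂ s₂)
... | no ¬s₁ | no ¬s₂ = no λ { (via-static2₁ s₁) → ¬s₁ s₁ ; (via-static2₂ s₂) → ¬s₂ s₂ }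
successful? (LOOP pz c) = yes (tick-loop pz c)
successful? (PRUNE _ _ _) = no λ ()
successful? (PRUNE0 _ _ _ _) = no λ ()
successful? (TRANSITION _ _ _ _ _ _ t) = map′ via-trans (λ { (via-trans s) → s }) (successful? t)

mainTheorem2 : ∀ (φ : Formula) → Satisfiable φ → (t : Tab [] (φ ∷ [])) → Successful t
mainTheorem2 φ (M , π , ⊨φ) t with successful? t
... | yes s  = s
... | no ¬s = ⊥-elim (walk t ¬s root λ { (_ , _ , () , _) })
  where
  open Semantics M π
  root : Invariant [] (φ ∷ []) (λ _ → φ ∷ []) (λ _ → 0) 0 0
  root = record
    { depth        = refl
    ; branch       = λ { z≤n → at-here }
    ; holds        = λ { (here refl) → ⊨φ }
    ; persists     = λ _ a<b b≤0 → ⊥-elim (<⇒≱ a<b (≤-trans b≤0 z≤n))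
    ; onlyNow      = λ _ ()
    ; poisedBefore = λ ()
    }
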